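{- Let $N>2t^2+t$. In the system model below, Algorithm B solves order-preserving renaming with target namespace of size $N^2$ in $2$ communication steps: every correct process outputs an integer in $[1,\dots,N^2]$, and for any two correct processes with original identifiers $id<id'$, the new name of the process with $id$ is strictly smaller than that of the process with $id'$.
   Context: System model: $N$ processes (with $N$ known to all) in a fully connected synchronous message-passing network. Computation proceeds in synchronous communication steps; messages sent in a step are received in that step. Each process's links are labeled $1,\dots,N$ (link $N$ a self-loop); a receiver knows the label of the link on which a message arrived, but not the sender's identifier. Channels are reliable. Each correct process has a unique original identifier (an integer in $[1,N_{max}]$), initially known only to itself. Up to $t$ processes are Byzantine and may behave arbitrarily. "Broadcast" means send to all $N$ links. Algorithm B (each correct process): Step 1: broadcast $\langle ID, my\_id\rangle$; for each $\langle ID,id\rangle$ received on link $lnk$ set linkid$[lnk]:=id$ and add $id$ to the set timely (linkid$[lnk]=\perp$ for links with no ID message). Step 2: broadcast $\langle MULTIECHO,\text{timely}\rangle$; for each $\langle MULTIECHO, ids\rangle$ received on link $lnk$, if linkid$[lnk]\ne\perp$, $|ids|\le N$ and $|\text{timely}\cap ids|\ge N-t$, then for each $id\in ids$ add $id$ to accepted and increment counter$[id]$ (initially $0$). Then, for each $id\in$ accepted, newid$[id]:=\sum_{id''\in \text{accepted},\, id''\le id}\min(\text{counter}[id''],N-t)$; output newid$[my\_id]$. -}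

module Defs where

open import Data.Nat using (ℕ; zero; suc; _+_; _*_; _∸_; _≤_; _<_; _≤ᵇ_; _⊓_)
import Data.Nat as ℕ
open import Data.Bool using (Bool; true; false; if_then_else_; _∧_; not; T)
open import Data.Fin using (Fin; toℕ)
open import Data.List using (List; []; _∷_; length; filter; mapMaybe; map; concat; deduplicate; allFin)
open import Data.List.Membership.DecPropositional ℕ._≟_ using (_∈?_)
open import Data.Nat.ListAction using (sum)
open import Data.Maybe using (Maybe; just; nothing)
open import Relation.Nullary.Decidable using (T?)

-- Each process p labels its links by Fin N
-- (label ℓ ∈ Fin N stands for link number toℕ ℓ + 1); port p ℓ is the
-- process at the other end of link ℓ of p.
-- correct p = true iff p is correct.  myid p is the original identifier
-- of p (only meaningful for correct p).
-- Byzantine behaviour: in step 1 a faulty process b sends to receiver p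
-- either no ID message (nothing) or ⟨ID, x⟩ (just x) — byz1 b p;
-- in step 2 it sends to p either no MULTIECHO message or
-- ⟨MULTIECHO, ids⟩ for a finite set ids (a duplicate-free list) — byz2 b p.
-- The adversary is arbitrary (quantified universally, full information).

record Execution (N : ℕ) : Set where
  field
    correct : Fin N → Bool
    myid    : Fin N → ℕ
    port    : Fin N → Fin N → Fin N
    byz1    : Fin N → Fin N → Maybe ℕ
    byz2    : Fin N → Fin N → Maybe (List ℕ)

module AlgorithmB {N : ℕ} (t : ℕ) (E : Execution N) where
  open Execution E

  linkid : Fin N → Fin N → Maybe ℕ
  linkid p l = let q = port p l in
    if correct q then just (myid q) else byz1 q p

  timely : Fin N → List ℕ
  timely p = deduplicate ℕ._≟_ (mapMaybe (linkid p) (allFin N))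

  echo : Fin N → Fin N → Maybe (List ℕ)
  echo p l = let q = port p l in
    if correct q then just (timely q) else byz2 q p

  -- |timely ∩ ids| (ids is duplicate-free)
  interSize : List ℕ → List ℕ → ℕ
  interSize tm ids = length (filter (λ x → x ∈? tm) ids)

  validEcho : Fin N → Fin N → Maybe (List ℕ)
  validEcho p l with linkid p l | echo p l
  ... | nothing | _ = nothing
  ... | just _  | nothing = nothing
  ... | just _  | just ids =
        if (length ids ≤ᵇ N) ∧ ((N ∸ t) ≤ᵇ interSize (timely p) ids)
        then just ids else nothing

  acceptedEchoes : Fin N → List (List ℕ)
  acceptedEchoes p = mapMaybe (validEcho p) (allFin N)

  accepted : Fin N → List ℕ
  accepted p = deduplicate ℕ._≟_ (concat (acceptedEchoes p))

  counter : Fin N → ℕ → ℕ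
  counter p x = length (filter (λ ids → x ∈? ids) (acceptedEchoes p))

  newid : Fin N → ℕ → ℕ
  newid p x = sum (map (λ y → counter p y ⊓ (N ∸ t))
                       (filter (λ y → y ℕ.≤? x) (accepted p)))

  output : Fin N → ℕ
  output p = newid p (myid p)

faultyCount : {N : ℕ} → Execution N → ℕ
faultyCount {N} E = length (filter (λ p → T? (not (Execution.correct E p))) (allFin N))

module Submission where

-- Let weight p y = min(counter p y, N - t).  Unaccepted identifiers have counter 0, so
-- newid p x is the sum of weight p y over the whole range y ≤ x, which makes the outputs
-- of different processes comparable term by term.  The argument then has three steps.
--  * Every correct identifier lies in every timely set, so any two timely sets share at
--    least N - t identifiers: every process accepts the echo of every correct neighbour,
--    and every correct identifier gets the full weight N - t at every process.
--  * Correct processes send the same echo to everybody, hence the weights that p and q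
--    give to y differ at most by the votes p received for y from faulty neighbours; these
--    only matter for forged (non-correct) identifiers.
--  * An accepted echo has at most t entries outside the receiver's timely set and at most
--    t forged entries inside it, so the ≤ t faulty neighbours cast ≤ t · 2t forged votes.
-- As t · 2t < N - t, the weight of myid q alone beats them: myid p < myid q implies
-- output p < output q.  Validity: the self-loop makes myid p accepted with weight
-- N - t ≥ 1, and an output never exceeds the N · N votes received.

open import Data.Nat using (ℕ; zero; suc; _+_; _*_; _∸_; _≤_; _<_; z≤n; s≤s; _⊓_; _≟_; _≤ᵇ_; _≤?_)
open import Data.List.Membership.DecPropositional _≟_ using (_∈?_)
open import Data.Nat.Properties hiding (_≟_; _≤?_)
open import Data.Nat.Solver using (module +-*-Solver)
open +-*-Solver using (solve; _:*_; _:+_; _:=_; con)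
open import Data.Nat.ListAction using (sum)
open import Data.Nat.ListAction.Properties using (sum-↭)
open import Data.List using (List; []; _∷_; length; map; filter; mapMaybe; concat; deduplicate; allFin)
open import Data.List.Properties using (length-filter; length-deduplicate; length-tabulate; length-map; length-mapMaybe)
open import Data.List.Membership.Propositional using (_∈_; _∉_)
open import Data.List.Membership.Propositional.Properties using (∈-filter⁺; ∈-filter⁻; ∈-map⁺; ∈-map⁻; ∈-allFin; ∈-deduplicate⁺; ∈-deduplicate⁻; ∈-concat⁺′)
open import Data.List.Membership.Propositional.Properties.WithK using (unique∧set⇒bag)
import Data.List.Membership.DecPropositional as DecMembership
open import Data.List.Relation.Unary.Any using (here; there)
import Data.List.Relation.Unary.All as All
import Data.List.Relation.Unary.All.Properties as AllP
open import Data.List.Relation.Unary.AllPairs using ([]; _∷_)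
open import Data.List.Relation.Unary.Unique.Propositional using (Unique)
import Data.List.Relation.Unary.Unique.Propositional.Properties as Unique
open import Data.List.Relation.Unary.Unique.DecPropositional.Properties using (deduplicate-!)
open import Data.List.Relation.Binary.BagAndSetEquality using (∼bag⇒↭)
open import Data.List.Relation.Binary.Permutation.Propositional using (_↭_)
open import Data.List.Relation.Binary.Permutation.Propositional.Properties using (↭-length)
import Data.List.Relation.Binary.Permutation.Propositional.Properties as Perm
open import Data.Fin using (Fin; punchOut; toℕ; fromℕ)
open import Data.Fin.Properties using (injective⇒≤; punchOut-injective; any?; toℕ-fromℕ)
import Data.Fin as Fin
open import Defs
open import Data.Bool using (Bool; true; false; T; not; if_then_else_)
open import Relation.Nullary.Decidable using (T?)
open import Data.Maybe using (Maybe; just; nothing; maybe)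
open import Data.Product using (_×_; _,_; proj₁; proj₂; ∃)
open import Data.Empty using (⊥-elim)
open import Data.Sum using (inj₁; inj₂)
open import Relation.Nullary using (Dec; yes; no; ¬_; ¬?; _×-dec_)
open import Relation.Binary.Definitions using (DecidableEquality)
open import Relation.Binary.PropositionalEquality
open import Function.Bundles using (mk⇔; _⇔_; Equivalence)
open import Data.Bool.Properties using (T-∧)
open import Function.Base using (_∘_; id)
open import Function.Definitions using (Injective)
open import Algebra.Properties.CommutativeSemigroup +-commutativeSemigroup using (interchange)

𝟙 : ∀ {p} {P : Set p} → Dec P → ℕ
𝟙 (yes _) = 1
𝟙 (no _)  = 0

𝟙≤1 : ∀ {p} {P : Set p} (d : Dec P) → 𝟙 d ≤ 1
𝟙≤1 (yes _) = s≤s z≤n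
𝟙≤1 (no _)  = z≤n

𝟙-true : ∀ {p} {P : Set p} (d : Dec P) → P → 𝟙 d ≡ 1
𝟙-true (yes _) _ = refl
𝟙-true (no ¬p) x = ⊥-elim (¬p x)

𝟙-false : ∀ {p} {P : Set p} (d : Dec P) → ¬ P → 𝟙 d ≡ 0
𝟙-false (yes x) ¬p = ⊥-elim (¬p x)
𝟙-false (no _)  _  = refl

𝟙-complement : ∀ {p} {P : Set p} (d : Dec P) → 𝟙 d + 𝟙 (¬? d) ≡ 1
𝟙-complement (yes _) = refl
𝟙-complement (no _)  = refl

𝟙≤𝟙¬+𝟙× : ∀ {p q} {P : Set p} {Q : Set q} (a : Dec P) (d : Dec Q) → 𝟙 d ≤ 𝟙 (¬? a) + 𝟙 (a ×-dec d)
𝟙≤𝟙¬+𝟙× (yes _) (yes _) = ≤-refl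
𝟙≤𝟙¬+𝟙× (yes _) (no _)  = z≤n
𝟙≤𝟙¬+𝟙× (no _)  d       = ≤-trans (𝟙≤1 d) (s≤s z≤n)

⊓-shift : ∀ a b c d → a ≤ b + d → a ⊓ c ≤ b ⊓ c + d
⊓-shift a b c d a≤b+d with ≤-total b c
... | inj₁ b≤c = ≤-trans (m⊓n≤m a c) (≤-trans a≤b+d (≤-reflexive (cong (_+ d) (sym (m≤n⇒m⊓n≡m b≤c)))))
... | inj₂ c≤b = ≤-trans (m⊓n≤n a c) (≤-trans (m≤m+n c d) (≤-reflexive (cong (_+ d) (sym (m≥n⇒m⊓n≡n c≤b)))))

∑ : ∀ {a} {A : Set a} → List A → (A → ℕ) → ℕ
∑ xs f = sum (map f xs)

module _ {a} {A : Set a} where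

  ∑-cong : ∀ xs {f g : A → ℕ} → (∀ x → f x ≡ g x) → ∑ xs f ≡ ∑ xs g
  ∑-cong []       eq = refl
  ∑-cong (x ∷ xs) eq = cong₂ _+_ (eq x) (∑-cong xs eq)

  ∑-mono : ∀ xs {f g : A → ℕ} → (∀ x → f x ≤ g x) → ∑ xs f ≤ ∑ xs g
  ∑-mono []       le = z≤n
  ∑-mono (x ∷ xs) le = +-mono-≤ (le x) (∑-mono xs le)

  ∑-+ : ∀ xs (f g : A → ℕ) → ∑ xs (λ x → f x + g x) ≡ ∑ xs f + ∑ xs g
  ∑-+ []       f g = refl
  ∑-+ (x ∷ xs) f g = trans (cong (f x + g x +_) (∑-+ xs f g)) (interchange (f x) (g x) _ _)

  ∑-const : ∀ xs c → ∑ xs (λ (_ : A) → c) ≡ length xs * c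
  ∑-const []       c = refl
  ∑-const (x ∷ xs) c = cong (c +_) (∑-const xs c)

  ∑-1≡length : ∀ xs → ∑ xs (λ (_ : A) → 1) ≡ length xs
  ∑-1≡length xs = trans (∑-const xs 1) (*-identityʳ (length xs))

  ∑-weighted≤ : ∀ xs (w g : A → ℕ) B → (∀ x → g x ≤ B) → ∑ xs (λ x → w x * g x) ≤ ∑ xs w * B
  ∑-weighted≤ []       w g B le = z≤n
  ∑-weighted≤ (x ∷ xs) w g B le = begin
    w x * g x + ∑ xs (λ x → w x * g x) ≤⟨ +-mono-≤ (*-monoʳ-≤ (w x) (le x)) (∑-weighted≤ xs w g B le) ⟩
    w x * B + ∑ xs w * B               ≡⟨ *-distribʳ-+ B (w x) (∑ xs w) ⟨
    (w x + ∑ xs w) * B                 ∎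
    where open ≤-Reasoning

  ∑-map : ∀ {b} {B : Set b} (f : A → B) xs (h : B → ℕ) → ∑ (map f xs) h ≡ ∑ xs (λ x → h (f x))
  ∑-map f []       h = refl
  ∑-map f (x ∷ xs) h = cong (h (f x) +_) (∑-map f xs h)

  ∑-𝟙+∑-𝟙¬ : ∀ {p} {P : A → Set p} (P? : ∀ x → Dec (P x)) xs →
             ∑ xs (λ x → 𝟙 (P? x)) + ∑ xs (λ x → 𝟙 (¬? (P? x))) ≡ length xs
  ∑-𝟙+∑-𝟙¬ P? xs = begin
    ∑ xs (λ x → 𝟙 (P? x)) + ∑ xs (λ x → 𝟙 (¬? (P? x))) ≡⟨ ∑-+ xs _ _ ⟨
    ∑ xs (λ x → 𝟙 (P? x) + 𝟙 (¬? (P? x)))               ≡⟨ ∑-cong xs (λ x → 𝟙-complement (P? x)) ⟩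
    ∑ xs (λ _ → 1)                                      ≡⟨ ∑-1≡length xs ⟩
    length xs                                           ∎
    where open ≡-Reasoning

  length-filter≡∑ : ∀ {p} {P : A → Set p} (P? : ∀ x → Dec (P x)) xs →
                    length (filter P? xs) ≡ ∑ xs (λ x → 𝟙 (P? x))
  length-filter≡∑ P? []       = refl
  length-filter≡∑ P? (x ∷ xs) with P? x
  ... | yes _ = cong suc (length-filter≡∑ P? xs)
  ... | no  _ = length-filter≡∑ P? xs

-- Sums over the initial segment {0, …, K-1} of ℕ.  Identifiers are compared through such
-- sums, since the sets of identifiers accepted by different processes differ.
∑< : ℕ → (ℕ → ℕ) → ℕ
∑< zero    f = 0
∑< (suc K) f = ∑< K f + f K

∑<-cong : ∀ K {f g} → (∀ y → y < K → f y ≡ g y) → ∑< K f ≡ ∑< K g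
∑<-cong zero    eq = refl
∑<-cong (suc K) eq = cong₂ _+_ (∑<-cong K (λ y y<K → eq y (m<n⇒m<1+n y<K))) (eq K ≤-refl)

∑<-mono : ∀ K {f g} → (∀ y → f y ≤ g y) → ∑< K f ≤ ∑< K g
∑<-mono zero    le = z≤n
∑<-mono (suc K) le = +-mono-≤ (∑<-mono K le) (le K)

∑<-+ : ∀ K f g → ∑< K (λ y → f y + g y) ≡ ∑< K f + ∑< K g
∑<-+ zero    f g = refl
∑<-+ (suc K) f g = trans (cong (_+ (f K + g K)) (∑<-+ K f g)) (interchange (∑< K f) (∑< K g) _ _)

∑<-zero : ∀ K → ∑< K (λ _ → 0) ≡ 0
∑<-zero zero    = refl
∑<-zero (suc K) = cong (_+ 0) (∑<-zero K)

∑<-scale : ∀ c f K → ∑< K (λ y → c * f y) ≡ c * ∑< K f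
∑<-scale c f zero    = sym (*-zeroʳ c)
∑<-scale c f (suc K) = trans (cong (_+ c * f K) (∑<-scale c f K)) (sym (*-distribˡ-+ c (∑< K f) (f K)))

∑<-prefix : ∀ f {K K′} → K ≤ K′ → ∑< K f ≤ ∑< K′ f
∑<-prefix f {K} {zero}   z≤n = ≤-refl
∑<-prefix f {K} {suc K′} K≤1+K′ with m≤n⇒m<n∨m≡n K≤1+K′
... | inj₁ K<1+K′ = ≤-trans (∑<-prefix f (≤-pred K<1+K′)) (m≤m+n _ _)
... | inj₂ refl   = ≤-refl

∑<-∑ : ∀ {a} {A : Set a} (xs : List A) (F : ℕ → A → ℕ) K →
       ∑< K (λ y → ∑ xs (F y)) ≡ ∑ xs (λ x → ∑< K (λ y → F y x))
∑<-∑ xs F zero    = sym (trans (∑-const xs 0) (*-zeroʳ (length xs)))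
∑<-∑ xs F (suc K) = trans (cong (_+ ∑ xs (F K)) (∑<-∑ xs F K))
                          (sym (∑-+ xs (λ x → ∑< K (λ y → F y x)) (F K)))

private
  𝟙-<-suc : ∀ a K → 𝟙 (a <? suc K) ≡ 𝟙 (a <? K) + 𝟙 (K ≟ a)
  𝟙-<-suc a K with a <? K | K ≟ a | a <? suc K
  ... | yes _   | no _     | yes _   = refl
  ... | no _    | yes _    | yes _   = refl
  ... | no _    | no _     | no _    = refl
  ... | yes a<K | yes refl | _       = ⊥-elim (<-irrefl refl a<K)
  ... | yes a<K | no _     | no a≮1+K = ⊥-elim (a≮1+K (m<n⇒m<1+n a<K))
  ... | no _    | yes refl | no a≮1+K = ⊥-elim (a≮1+K ≤-refl)
  ... | no a≮K  | no K≢a   | yes a<1+K = ⊥-elim (a≮K (≤∧≢⇒< (≤-pred a<1+K) (K≢a ∘ sym)))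

  𝟙-≟-subst : ∀ (g : ℕ → ℕ) y a → 𝟙 (y ≟ a) * g y ≡ 𝟙 (y ≟ a) * g a
  𝟙-≟-subst g y a with y ≟ a
  ... | yes refl = refl
  ... | no _     = refl

∑<-point : ∀ a g K → ∑< K (λ y → 𝟙 (y ≟ a) * g y) ≡ 𝟙 (a <? K) * g a
∑<-point a g zero    = refl
∑<-point a g (suc K) = begin
  ∑< K (λ y → 𝟙 (y ≟ a) * g y) + 𝟙 (K ≟ a) * g K ≡⟨ cong₂ _+_ (∑<-point a g K) (𝟙-≟-subst g K a) ⟩
  𝟙 (a <? K) * g a + 𝟙 (K ≟ a) * g a               ≡⟨ *-distribʳ-+ (g a) (𝟙 (a <? K)) (𝟙 (K ≟ a)) ⟨
  (𝟙 (a <? K) + 𝟙 (K ≟ a)) * g a                   ≡⟨ cong (_* g a) (𝟙-<-suc a K) ⟨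
  𝟙 (a <? suc K) * g a                             ∎
  where open ≡-Reasoning

𝟙-∈-∷≤ : ∀ y a L → 𝟙 (y ∈? (a ∷ L)) ≤ 𝟙 (y ≟ a) + 𝟙 (y ∈? L)
𝟙-∈-∷≤ y a L with y ≟ a | y ∈? L
... | yes _ | _     = s≤s z≤n
... | no _  | yes _ = s≤s z≤n
... | no _  | no _  = z≤n

𝟙-∈-∷ : ∀ y a L → a ∉ L → 𝟙 (y ∈? (a ∷ L)) ≡ 𝟙 (y ≟ a) + 𝟙 (y ∈? L)
𝟙-∈-∷ y a L a∉L with y ≟ a | y ∈? L
... | yes refl | yes a∈L = ⊥-elim (a∉L a∈L)
... | yes _    | no _    = refl
... | no _     | yes _   = refl
... | no _     | no _    = refl

∑<-members≤ : ∀ L g K → ∑< K (λ y → 𝟙 (y ∈? L) * g y) ≤ ∑ L g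
∑<-members≤ []      g K = ≤-reflexive (∑<-zero K)
∑<-members≤ (a ∷ L) g K = begin
  ∑< K (λ y → 𝟙 (y ∈? (a ∷ L)) * g y)
    ≤⟨ ∑<-mono K (λ y → *-monoˡ-≤ (g y) (𝟙-∈-∷≤ y a L)) ⟩
  ∑< K (λ y → (𝟙 (y ≟ a) + 𝟙 (y ∈? L)) * g y)
    ≡⟨ ∑<-cong K (λ y _ → *-distribʳ-+ (g y) (𝟙 (y ≟ a)) (𝟙 (y ∈? L))) ⟩
  ∑< K (λ y → 𝟙 (y ≟ a) * g y + 𝟙 (y ∈? L) * g y)
    ≡⟨ ∑<-+ K _ _ ⟩
  ∑< K (λ y → 𝟙 (y ≟ a) * g y) + ∑< K (λ y → 𝟙 (y ∈? L) * g y)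
    ≤⟨ +-mono-≤ (≤-trans (≤-reflexive (∑<-point a g K)) (*-monoˡ-≤ (g a) (𝟙≤1 (a <? K))))
                (∑<-members≤ L g K) ⟩
  1 * g a + ∑ L g
    ≡⟨ cong (_+ ∑ L g) (*-identityˡ (g a)) ⟩
  g a + ∑ L g ∎
  where open ≤-Reasoning

∑<-members : ∀ L g K → Unique L → (∀ y → y ∈ L → y < K) → ∑< K (λ y → 𝟙 (y ∈? L) * g y) ≡ ∑ L g
∑<-members []      g K _      _   = ∑<-zero K
∑<-members (a ∷ L) g K uniqaL L<K = begin
  ∑< K (λ y → 𝟙 (y ∈? (a ∷ L)) * g y)
    ≡⟨ ∑<-cong K (λ y _ → trans (cong (_* g y) (𝟙-∈-∷ y a L a∉L))
                                (*-distribʳ-+ (g y) (𝟙 (y ≟ a)) (𝟙 (y ∈? L)))) ⟩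
  ∑< K (λ y → 𝟙 (y ≟ a) * g y + 𝟙 (y ∈? L) * g y)
    ≡⟨ ∑<-+ K _ _ ⟩
  ∑< K (λ y → 𝟙 (y ≟ a) * g y) + ∑< K (λ y → 𝟙 (y ∈? L) * g y)
    ≡⟨ cong₂ _+_ (trans (∑<-point a g K) (cong (_* g a) (𝟙-true (a <? K) (L<K a (here refl)))))
                 (∑<-members L g K (Unique.drop⁺ 1 uniqaL) (λ y y∈L → L<K y (there y∈L))) ⟩
  1 * g a + ∑ L g
    ≡⟨ cong (_+ ∑ L g) (*-identityˡ (g a)) ⟩
  g a + ∑ L g ∎
  where
  open ≡-Reasoning
  a∉L : a ∉ L
  a∉L = Unique.Unique[x∷xs]⇒x∉xs uniqaL

unique-same-members⇒↭ : ∀ {a} {A : Set a} {xs ys : List A} → Unique xs → Unique ys →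
                        (∀ {x} → x ∈ xs ⇔ x ∈ ys) → xs ↭ ys
unique-same-members⇒↭ uniq-xs uniq-ys same = ∼bag⇒↭ (unique∧set⇒bag uniq-xs uniq-ys same)

unique-⊆⇒length≤ : ∀ {a} {A : Set a} (_≟ᴬ_ : DecidableEquality A) {xs ys : List A} →
                   Unique xs → (∀ {x} → x ∈ xs → x ∈ ys) → length xs ≤ length ys
unique-⊆⇒length≤ _≟ᴬ_ {xs} {ys} uniq-xs xs⊆ys = begin
  length xs                    ≡⟨ ↭-length (unique-same-members⇒↭ uniq-xs uniq-zs (mk⇔ to from)) ⟩
  length zs                    ≤⟨ length-filter (_∈ᴬ? xs) (deduplicate _≟ᴬ_ ys) ⟩
  length (deduplicate _≟ᴬ_ ys) ≤⟨ length-deduplicate _≟ᴬ_ ys ⟩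
  length ys                    ∎
  where
  open ≤-Reasoning
  open DecMembership _≟ᴬ_ using () renaming (_∈?_ to _∈ᴬ?_)
  zs = filter (_∈ᴬ? xs) (deduplicate _≟ᴬ_ ys)
  uniq-zs : Unique zs
  uniq-zs = Unique.filter⁺ (_∈ᴬ? xs) (deduplicate-! _≟ᴬ_ ys)
  to : ∀ {x} → x ∈ xs → x ∈ zs
  to x∈xs = ∈-filter⁺ (_∈ᴬ? xs) (∈-deduplicate⁺ _≟ᴬ_ (xs⊆ys x∈xs)) x∈xs
  from : ∀ {x} → x ∈ zs → x ∈ xs
  from x∈zs = proj₂ (∈-filter⁻ (_∈ᴬ? xs) {xs = deduplicate _≟ᴬ_ ys} x∈zs)

Unique-map⁺ : ∀ {a b} {A : Set a} {B : Set b} (f : A → B) {xs : List A} →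
              (∀ {x y} → x ∈ xs → y ∈ xs → f x ≡ f y → x ≡ y) → Unique xs → Unique (map f xs)
Unique-map⁺ f {[]}     f-inj []             = []
Unique-map⁺ f {x ∷ xs} f-inj (x∉xs ∷ uniq) =
  AllP.map⁺ (All.tabulate (λ y∈xs fx≡fy → All.lookup x∉xs y∈xs (f-inj (here refl) (there y∈xs) fx≡fy)))
  ∷ Unique-map⁺ f (λ x∈xs y∈xs → f-inj (there x∈xs) (there y∈xs)) uniq

injective⇒surjective : ∀ {n} {f : Fin n → Fin n} → Injective _≡_ _≡_ f → ∀ r → ∃ λ l → f l ≡ r
injective⇒surjective {suc n} {f} f-inj r with any? (λ l → f l Fin.≟ r)
... | yes hit = hit
... | no miss = ⊥-elim (<-irrefl refl (injective⇒≤ punched-inj))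
  where
  r∉image : ∀ l → r ≢ f l
  r∉image l r≡fl = miss (l , sym r≡fl)
  punched : Fin (suc n) → Fin n
  punched l = punchOut (r∉image l)
  punched-inj : Injective _≡_ _≡_ punched
  punched-inj {l} {l′} eq = f-inj (punchOut-injective (r∉image l) (r∉image l′) eq)

-- A nonempty finite set has a greatest element; links labelled by it are self-loops.
greatest : ∀ {n} → Fin n → Fin n
greatest {suc n} _ = fromℕ n

suc-toℕ-greatest : ∀ {n} (i : Fin n) → suc (toℕ (greatest i)) ≡ n
suc-toℕ-greatest {suc n} _ = cong suc (toℕ-fromℕ n)

∑-reindex : ∀ {n} {f : Fin n → Fin n} → Injective _≡_ _≡_ f → ∀ (h : Fin n → ℕ) →
            ∑ (allFin n) (λ l → h (f l)) ≡ ∑ (allFin n) h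
∑-reindex {n} {f} f-inj h = trans (sym (∑-map f (allFin n) h)) (sum-↭ (Perm.map⁺ h image↭all))
  where
  in-image : ∀ {x} → ∃ (λ l → f l ≡ x) → x ∈ map f (allFin n)
  in-image (l , refl) = ∈-map⁺ f (∈-allFin l)
  image↭all : map f (allFin n) ↭ allFin n
  image↭all = unique-same-members⇒↭ (Unique.map⁺ f-inj (Unique.allFin⁺ n)) (Unique.allFin⁺ n)
    (mk⇔ (λ _ → ∈-allFin _) (λ _ → in-image (injective⇒surjective f-inj _)))

module _ {a b} {A : Set a} {B : Set b} (g : A → Maybe B) where

  ∈-mapMaybe⁺ : ∀ {x v} xs → x ∈ xs → g x ≡ just v → v ∈ mapMaybe g xs
  ∈-mapMaybe⁺ (x ∷ xs) (here refl) gx≡v rewrite gx≡v = here refl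
  ∈-mapMaybe⁺ (y ∷ xs) (there x∈xs) gx≡v with g y
  ... | nothing = ∈-mapMaybe⁺ xs x∈xs gx≡v
  ... | just _  = there (∈-mapMaybe⁺ xs x∈xs gx≡v)

  length-filter-mapMaybe : ∀ {p} {P : B → Set p} (P? : ∀ v → Dec (P v)) xs →
    length (filter P? (mapMaybe g xs)) ≡ ∑ xs (λ x → maybe (λ v → 𝟙 (P? v)) 0 (g x))
  length-filter-mapMaybe P? []       = refl
  length-filter-mapMaybe P? (x ∷ xs) with g x
  ... | nothing = length-filter-mapMaybe P? xs
  ... | just v with P? v
  ...   | yes _ = cong suc (length-filter-mapMaybe P? xs)
  ...   | no _  = length-filter-mapMaybe P? xs

if-T : ∀ {a} {A : Set a} {b : Bool} {x y : A} → T b → (if b then x else y) ≡ x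
if-T {b = true} _ = refl

module Analysis {N : ℕ} (t : ℕ) (E : Execution N) where
  open Execution E
  open AlgorithmB t E

  processes : List (Fin N)
  processes = allFin N

  length-processes : length processes ≡ N
  length-processes = length-tabulate id

  correct? : ∀ q → Dec (T (correct q))
  correct? q = T? (correct q)

  linkid-correct : ∀ p l → T (correct (port p l)) → linkid p l ≡ just (myid (port p l))
  linkid-correct p l = if-T

  echo-correct : ∀ p l → T (correct (port p l)) → echo p l ≡ just (timely (port p l))
  echo-correct p l = if-T

  validEcho-sound : ∀ p l ids → validEcho p l ≡ just ids →
    echo p l ≡ just ids × length ids ≤ N × N ∸ t ≤ interSize (timely p) ids
  validEcho-sound p l ids accepted-ids with linkid p l | echo p l
  ... | just _ | just ids′ with length ids′ ≤ᵇ N in small | (N ∸ t) ≤ᵇ interSize (timely p) ids′ in enough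
  ...   | true | true with accepted-ids
  ...     | refl = refl , ≤ᵇ⇒≤ _ N (subst T (sym small) _) , ≤ᵇ⇒≤ (N ∸ t) _ (subst T (sym enough) _)

  validEcho-complete : ∀ p l a ids → linkid p l ≡ just a → echo p l ≡ just ids →
    length ids ≤ N → N ∸ t ≤ interSize (timely p) ids → validEcho p l ≡ just ids
  validEcho-complete p l a ids has-id has-echo small enough with linkid p l | echo p l
  validEcho-complete p l a ids refl refl small enough | .(just a) | .(just ids) =
    if-T (Equivalence.from T-∧ (≤⇒≤ᵇ small , ≤⇒≤ᵇ enough))

  -- At most one identifier arrives per link.
  length-timely≤N : ∀ q → length (timely q) ≤ N
  length-timely≤N q = begin
    length (timely q)                           ≤⟨ length-deduplicate _≟_ (mapMaybe (linkid q) processes) ⟩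
    length (mapMaybe (linkid q) processes)      ≤⟨ length-mapMaybe (linkid q) processes ⟩
    length processes                            ≡⟨ length-processes ⟩
    N                                           ∎
    where open ≤-Reasoning

  vote : Fin N → ℕ → Fin N → ℕ
  vote p y l = maybe (λ ids → 𝟙 (y ∈? ids)) 0 (validEcho p l)

  counter≡∑votes : ∀ p y → counter p y ≡ ∑ processes (vote p y)
  counter≡∑votes p y = length-filter-mapMaybe (validEcho p) (y ∈?_) processes

  accepted⁺ : ∀ p l ids y → validEcho p l ≡ just ids → y ∈ ids → y ∈ accepted p
  accepted⁺ p l ids y accepted-ids y∈ids =
    ∈-deduplicate⁺ _≟_ (∈-concat⁺′ y∈ids (∈-mapMaybe⁺ (validEcho p) processes (∈-allFin l) accepted-ids))

  counter-unaccepted : ∀ p y → y ∉ accepted p → counter p y ≡ 0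
  counter-unaccepted p y y∉acc = begin
    counter p y                  ≡⟨ counter≡∑votes p y ⟩
    ∑ processes (vote p y)       ≡⟨ ∑-cong processes (λ l → no-vote l (validEcho p l) refl) ⟩
    ∑ processes (λ _ → 0)        ≡⟨ ∑-const processes 0 ⟩
    length processes * 0         ≡⟨ *-zeroʳ (length processes) ⟩
    0                            ∎
    where
    open ≡-Reasoning
    no-vote : ∀ l m → validEcho p l ≡ m → maybe (λ ids → 𝟙 (y ∈? ids)) 0 m ≡ 0
    no-vote l nothing    _            = refl
    no-vote l (just ids) accepted-ids = 𝟙-false (y ∈? ids) (y∉acc ∘ accepted⁺ p l ids y accepted-ids)

  weight : Fin N → ℕ → ℕ
  weight p y = counter p y ⊓ (N ∸ t)

  -- newid is a sum over an initial segment of ℕ, since unaccepted identifiers have weight 0.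
  newid≡∑< : ∀ p x → newid p x ≡ ∑< (suc x) (weight p)
  newid≡∑< p x = begin
    newid p x                                        ≡⟨ ∑<-members below (weight p) (suc x) unique-below below-x ⟨
    ∑< (suc x) (λ y → 𝟙 (y ∈? below) * weight p y)   ≡⟨ ∑<-cong (suc x) only-below ⟩
    ∑< (suc x) (weight p)                            ∎
    where
    open ≡-Reasoning
    below : List ℕ
    below = filter (_≤? x) (accepted p)
    unique-below : Unique below
    unique-below = Unique.filter⁺ (_≤? x) (deduplicate-! _≟_ (concat (acceptedEchoes p)))
    below-x : ∀ y → y ∈ below → y < suc x
    below-x y y∈below = s≤s (proj₂ (∈-filter⁻ (_≤? x) {xs = accepted p} y∈below))
    only-below : ∀ y → y < suc x → 𝟙 (y ∈? below) * weight p y ≡ weight p y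
    only-below y y≤x with y ∈? below
    ... | yes _ = *-identityˡ (weight p y)
    ... | no y∉below = cong (_⊓ (N ∸ t)) (sym (counter-unaccepted p y
                         (λ y∈acc → y∉below (∈-filter⁺ (_≤? x) y∈acc (≤-pred y≤x)))))

  -- An accepted message has at most N entries, so it casts at most N votes.
  votes-per-link≤N : ∀ p l K → ∑< K (λ y → vote p y l) ≤ N
  votes-per-link≤N p l K = go (validEcho p l) refl
    where
    go : ∀ m → validEcho p l ≡ m → ∑< K (λ y → maybe (λ ids → 𝟙 (y ∈? ids)) 0 m) ≤ N
    go nothing    _            = ≤-trans (≤-reflexive (∑<-zero K)) z≤n
    go (just ids) accepted-ids = begin
      ∑< K (λ y → 𝟙 (y ∈? ids))     ≡⟨ ∑<-cong K (λ y _ → *-identityʳ (𝟙 (y ∈? ids))) ⟨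
      ∑< K (λ y → 𝟙 (y ∈? ids) * 1) ≤⟨ ∑<-members≤ ids (λ _ → 1) K ⟩
      ∑ ids (λ _ → 1)               ≡⟨ ∑-1≡length ids ⟩
      length ids                    ≤⟨ proj₁ (proj₂ (validEcho-sound p l ids accepted-ids)) ⟩
      N                             ∎
      where open ≤-Reasoning

  -- Every output lies below N², since it is at most the total number of votes received.
  output≤N² : ∀ p → output p ≤ N * N
  output≤N² p = begin
    output p                                          ≡⟨ newid≡∑< p (myid p) ⟩
    ∑< K (weight p)                                   ≤⟨ ∑<-mono K (λ y → m⊓n≤m (counter p y) (N ∸ t)) ⟩
    ∑< K (counter p)                                  ≡⟨ ∑<-cong K (λ y _ → counter≡∑votes p y) ⟩
    ∑< K (λ y → ∑ processes (vote p y))               ≡⟨ ∑<-∑ processes (vote p) K ⟩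
    ∑ processes (λ l → ∑< K (λ y → vote p y l))       ≤⟨ ∑-mono processes (λ l → votes-per-link≤N p l K) ⟩
    ∑ processes (λ _ → N)                             ≡⟨ ∑-const processes N ⟩
    length processes * N                              ≡⟨ cong (_* N) length-processes ⟩
    N * N                                             ∎
    where
    open ≤-Reasoning
    K = suc (myid p)

  correctIds : List ℕ
  correctIds = map myid (filter correct? processes)

  forged? : ∀ y → Dec (y ∉ correctIds)
  forged? y = ¬? (y ∈? correctIds)

  correctIds⁺ : ∀ q → T (correct q) → myid q ∈ correctIds
  correctIds⁺ q q-correct = ∈-map⁺ myid (∈-filter⁺ correct? (∈-allFin q) q-correct)

  correctIds⁻ : ∀ {y} → y ∈ correctIds → ∃ λ q → T (correct q) × y ≡ myid q
  correctIds⁻ y∈ids with ∈-map⁻ myid y∈ids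
  ... | q , q∈correct , refl = q , proj₂ (∈-filter⁻ correct? {xs = processes} q∈correct) , refl

  faulty : Fin N → ℕ
  faulty q = 𝟙 (T? (not (correct q)))

  correct+faulty : ∀ q → 𝟙 (correct? q) + faulty q ≡ 1
  correct+faulty q with correct q
  ... | true  = refl
  ... | false = refl

  faultyCount≡∑ : faultyCount E ≡ ∑ processes faulty
  faultyCount≡∑ = length-filter≡∑ (λ q → T? (not (correct q))) processes

  #correct+#faulty : length correctIds + faultyCount E ≡ N
  #correct+#faulty = begin
    length correctIds + faultyCount E
      ≡⟨ cong₂ _+_ (trans (length-map myid (filter correct? processes)) (length-filter≡∑ correct? processes))
                   faultyCount≡∑ ⟩
    ∑ processes (λ q → 𝟙 (correct? q)) + ∑ processes faulty
      ≡⟨ ∑-+ processes _ _ ⟨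
    ∑ processes (λ q → 𝟙 (correct? q) + faulty q)
      ≡⟨ ∑-cong processes correct+faulty ⟩
    ∑ processes (λ _ → 1)
      ≡⟨ ∑-1≡length processes ⟩
    length processes
      ≡⟨ length-processes ⟩
    N ∎
    where open ≡-Reasoning

  module Correctness (port-injective : ∀ p → Injective _≡_ _≡_ (port p))
           (ids-distinct : ∀ p q → T (correct p) → T (correct q) → myid p ≡ myid q → p ≡ q)
           (few-faulty : faultyCount E ≤ t)
           (byz-echo-unique : ∀ b p ids → byz2 b p ≡ just ids → Unique ids) where

    -- Every process is at the other end of exactly one link of p.
    ∑-neighbours : ∀ p (h : Fin N → ℕ) → ∑ processes (λ l → h (port p l)) ≡ ∑ processes h
    ∑-neighbours p = ∑-reindex (port-injective p)

    correctIds⊆timely : ∀ p {y} → y ∈ correctIds → y ∈ timely p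
    correctIds⊆timely p y∈ids with correctIds⁻ y∈ids
    ... | q , q-correct , refl with injective⇒surjective (port-injective p) q
    ...   | l , refl = ∈-deduplicate⁺ _≟_
                         (∈-mapMaybe⁺ (linkid p) processes (∈-allFin l) (linkid-correct p l q-correct))

    unique-correctIds : Unique correctIds
    unique-correctIds = Unique-map⁺ myid (λ p∈ q∈ → ids-distinct _ _ (correct-of p∈) (correct-of q∈))
                                         (Unique.filter⁺ correct? (Unique.allFin⁺ N))
      where
      correct-of : ∀ {q} → q ∈ filter correct? processes → T (correct q)
      correct-of q∈ = proj₂ (∈-filter⁻ correct? {xs = processes} q∈)

    enough-correct : N ∸ t ≤ length correctIds
    enough-correct = begin
      N ∸ t                                          ≤⟨ ∸-monoʳ-≤ N few-faulty ⟩
      N ∸ faultyCount E                              ≡⟨ cong (_∸ faultyCount E) #correct+#faulty ⟨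
      length correctIds + faultyCount E ∸ faultyCount E ≡⟨ m+n∸n≡m (length correctIds) (faultyCount E) ⟩
      length correctIds                              ∎
      where open ≤-Reasoning

    -- Any two timely sets share the N - t correct identifiers …
    timely-overlap : ∀ p q → N ∸ t ≤ interSize (timely p) (timely q)
    timely-overlap p q = ≤-trans enough-correct (unique-⊆⇒length≤ _≟_ unique-correctIds
      (λ y∈ids → ∈-filter⁺ (_∈? timely p) (correctIds⊆timely q y∈ids) (correctIds⊆timely p y∈ids)))

    -- … so every process accepts the MULTIECHO message of every correct process.
    correct-echo-accepted : ∀ p l → T (correct (port p l)) → validEcho p l ≡ just (timely (port p l))
    correct-echo-accepted p l q-correct =
      validEcho-complete p l _ _ (linkid-correct p l q-correct) (echo-correct p l q-correct)
                         (length-timely≤N (port p l)) (timely-overlap p (port p l))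

    vote-correct : ∀ p y l → T (correct (port p l)) → vote p y l ≡ 𝟙 (y ∈? timely (port p l))
    vote-correct p y l q-correct = cong (maybe (λ ids → 𝟙 (y ∈? ids)) 0) (correct-echo-accepted p l q-correct)

    honestVotes faultyVotes : Fin N → ℕ → ℕ
    honestVotes p y = ∑ processes (λ l → 𝟙 (correct? (port p l)) * vote p y l)
    faultyVotes p y = ∑ processes (λ l → faulty (port p l) * vote p y l)

    counter≡honest+faulty : ∀ p y → counter p y ≡ honestVotes p y + faultyVotes p y
    counter≡honest+faulty p y = begin
      counter p y             ≡⟨ counter≡∑votes p y ⟩
      ∑ processes (vote p y)  ≡⟨ ∑-cong processes split ⟩
      ∑ processes (λ l → 𝟙 (correct? (port p l)) * vote p y l + faulty (port p l) * vote p y l)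
                              ≡⟨ ∑-+ processes _ _ ⟩
      honestVotes p y + faultyVotes p y ∎
      where
      open ≡-Reasoning
      split : ∀ l → vote p y l ≡ 𝟙 (correct? (port p l)) * vote p y l + faulty (port p l) * vote p y l
      split l = sym (trans (sym (*-distribʳ-+ (vote p y l) (𝟙 (correct? (port p l))) (faulty (port p l))))
                           (trans (cong (_* vote p y l) (correct+faulty (port p l))) (*-identityˡ _)))

    timelyAt : ℕ → ℕ
    timelyAt y = ∑ processes (λ r → 𝟙 (correct? r) * 𝟙 (y ∈? timely r))

    -- Correct processes send the same echo to everybody: honest votes do not depend on the receiver.
    honestVotes≡timelyAt : ∀ p y → honestVotes p y ≡ timelyAt y
    honestVotes≡timelyAt p y = trans (∑-cong processes same-echo)
                                     (∑-neighbours p (λ r → 𝟙 (correct? r) * 𝟙 (y ∈? timely r)))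
      where
      same-echo : ∀ l → 𝟙 (correct? (port p l)) * vote p y l ≡ 𝟙 (correct? (port p l)) * 𝟙 (y ∈? timely (port p l))
      same-echo l with correct? (port p l)
      ... | yes q-correct = cong (1 *_) (vote-correct p y l q-correct)
      ... | no _          = refl

    timelyAt≤counter : ∀ p y → timelyAt y ≤ counter p y
    timelyAt≤counter p y = begin
      timelyAt y                        ≡⟨ honestVotes≡timelyAt p y ⟨
      honestVotes p y                   ≤⟨ m≤m+n _ _ ⟩
      honestVotes p y + faultyVotes p y ≡⟨ counter≡honest+faulty p y ⟨
      counter p y                       ∎
      where open ≤-Reasoning

    -- A correct identifier is in every timely set, so every process gives it the full weight N - t.
    correct-weight : ∀ p y → y ∈ correctIds → weight p y ≡ N ∸ t
    correct-weight p y y∈ids = m≥n⇒m⊓n≡n (begin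
      N ∸ t                                 ≤⟨ enough-correct ⟩
      length correctIds                     ≡⟨ length-map myid (filter correct? processes) ⟩
      length (filter correct? processes)    ≡⟨ length-filter≡∑ correct? processes ⟩
      ∑ processes (λ r → 𝟙 (correct? r))    ≡⟨ ∑-cong processes in-timely ⟨
      timelyAt y                            ≤⟨ timelyAt≤counter p y ⟩
      counter p y                           ∎)
      where
      open ≤-Reasoning
      in-timely : ∀ r → 𝟙 (correct? r) * 𝟙 (y ∈? timely r) ≡ 𝟙 (correct? r)
      in-timely r = trans (cong (𝟙 (correct? r) *_) (𝟙-true (y ∈? timely r) (correctIds⊆timely r y∈ids)))
                          (*-identityʳ _)

    -- Faulty votes for forged identifiers: the only way two weights can differ.
    forgedVotes : Fin N → ℕ → ℕ
    forgedVotes p y = ∑ processes (λ l → faulty (port p l) * (𝟙 (forged? y) * vote p y l))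

    weight-shift : ∀ p q y → weight p y ≤ weight q y + forgedVotes p y
    weight-shift p q y = by-cases (y ∈? correctIds)
      where
      open ≤-Reasoning
      by-cases : Dec (y ∈ correctIds) → weight p y ≤ weight q y + forgedVotes p y
      by-cases (yes y∈ids) = begin
        weight p y                    ≡⟨ trans (correct-weight p y y∈ids) (sym (correct-weight q y y∈ids)) ⟩
        weight q y                    ≤⟨ m≤m+n _ _ ⟩
        weight q y + forgedVotes p y  ∎
      by-cases (no y∉ids) = ⊓-shift (counter p y) (counter q y) (N ∸ t) (forgedVotes p y) (begin
        counter p y                       ≡⟨ counter≡honest+faulty p y ⟩
        honestVotes p y + faultyVotes p y ≤⟨ +-monoˡ-≤ _ (≤-trans (≤-reflexive (honestVotes≡timelyAt p y))
                                                                  (timelyAt≤counter q y)) ⟩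
        counter q y + faultyVotes p y     ≡⟨ cong (counter q y +_) (∑-cong processes all-forged) ⟨
        counter q y + forgedVotes p y     ∎)
        where
        all-forged : ∀ l → faulty (port p l) * (𝟙 (forged? y) * vote p y l) ≡ faulty (port p l) * vote p y l
        all-forged l = cong (faulty (port p l) *_)
                            (trans (cong (_* vote p y l) (𝟙-true (forged? y) y∉ids)) (*-identityˡ (vote p y l)))

    echo-unique : ∀ p l ids → echo p l ≡ just ids → Unique ids
    echo-unique p l ids with correct (port p l)
    ... | true  = λ { refl → deduplicate-! _≟_ _ }
    ... | false = byz-echo-unique (port p l) p ids

    -- A forged identifier in a timely set arrived over a link to a faulty process.
    forged-in-timely≤faulty : ∀ p → length (filter forged? (timely p)) ≤ faultyCount E
    forged-in-timely≤faulty p = begin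
      length (filter forged? (timely p))
        ≤⟨ unique-⊆⇒length≤ _≟_ (Unique.filter⁺ forged? (deduplicate-! _≟_ received)) drop-dedup ⟩
      length (filter forged? received)
        ≡⟨ length-filter-mapMaybe (linkid p) forged? processes ⟩
      ∑ processes (λ l → maybe (λ y → 𝟙 (forged? y)) 0 (linkid p l))
        ≤⟨ ∑-mono processes from-faulty ⟩
      ∑ processes (λ l → faulty (port p l))
        ≡⟨ ∑-neighbours p faulty ⟩
      ∑ processes faulty
        ≡⟨ faultyCount≡∑ ⟨
      faultyCount E ∎
      where
      open ≤-Reasoning
      received = mapMaybe (linkid p) processes
      drop-dedup : ∀ {y} → y ∈ filter forged? (timely p) → y ∈ filter forged? received
      drop-dedup y∈ = let (y∈timely , y-forged) = ∈-filter⁻ forged? {xs = timely p} y∈ in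
                      ∈-filter⁺ forged? (∈-deduplicate⁻ _≟_ received y∈timely) y-forged
      from-faulty : ∀ l → maybe (λ y → 𝟙 (forged? y)) 0 (linkid p l) ≤ faulty (port p l)
      from-faulty l with correct (port p l) in is-correct
      ... | true  = ≤-reflexive (𝟙-false (forged? _) (λ is-forged →
                      is-forged (correctIds⁺ (port p l) (subst T (sym is-correct) _))))
      ... | false with byz1 (port p l) p
      ...   | nothing = z≤n
      ...   | just y  = 𝟙≤1 (forged? y)

    outside-timely≤t : ∀ p l ids → validEcho p l ≡ just ids → ∑ ids (λ y → 𝟙 (¬? (y ∈? timely p))) ≤ t
    outside-timely≤t p l ids accepted-ids = +-cancelʳ-≤ (N ∸ t) _ t (begin
      outside + (N ∸ t)       ≤⟨ +-monoʳ-≤ outside enough ⟩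
      outside + inside        ≡⟨ +-comm outside inside ⟩
      inside + outside        ≡⟨ ∑-𝟙+∑-𝟙¬ (_∈? timely p) ids ⟩
      length ids              ≤⟨ small ⟩
      N                       ≤⟨ m≤n+m∸n N t ⟩
      t + (N ∸ t)             ∎)
      where
      open ≤-Reasoning
      inside outside : ℕ
      inside  = ∑ ids (λ y → 𝟙 (y ∈? timely p))
      outside = ∑ ids (λ y → 𝟙 (¬? (y ∈? timely p)))
      small : length ids ≤ N
      small = proj₁ (proj₂ (validEcho-sound p l ids accepted-ids))
      enough : N ∸ t ≤ inside
      enough = subst (N ∸ t ≤_) (length-filter≡∑ (_∈? timely p) ids)
                     (proj₂ (proj₂ (validEcho-sound p l ids accepted-ids)))

    forged-entries≤2t : ∀ p l ids → validEcho p l ≡ just ids → ∑ ids (λ y → 𝟙 (forged? y)) ≤ t + t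
    forged-entries≤2t p l ids accepted-ids = begin
      ∑ ids (λ y → 𝟙 (forged? y))
        ≤⟨ ∑-mono ids (λ y → 𝟙≤𝟙¬+𝟙× (y ∈? timely p) (forged? y)) ⟩
      ∑ ids (λ y → 𝟙 (¬? (y ∈? timely p)) + 𝟙 (forged-timely? y))
        ≡⟨ ∑-+ ids _ _ ⟩
      ∑ ids (λ y → 𝟙 (¬? (y ∈? timely p))) + ∑ ids (λ y → 𝟙 (forged-timely? y))
        ≡⟨ cong (∑ ids (λ y → 𝟙 (¬? (y ∈? timely p))) +_) (length-filter≡∑ forged-timely? ids) ⟨
      ∑ ids (λ y → 𝟙 (¬? (y ∈? timely p))) + length (filter forged-timely? ids)
        ≤⟨ +-mono-≤ (outside-timely≤t p l ids accepted-ids)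
                    (unique-⊆⇒length≤ _≟_ (Unique.filter⁺ forged-timely? unique-ids) forged-timely⊆) ⟩
      t + length (filter forged? (timely p))
        ≤⟨ +-monoʳ-≤ t (≤-trans (forged-in-timely≤faulty p) few-faulty) ⟩
      t + t ∎
      where
      open ≤-Reasoning
      forged-timely? : ∀ y → Dec (y ∈ timely p × y ∉ correctIds)
      forged-timely? y = (y ∈? timely p) ×-dec forged? y
      unique-ids : Unique ids
      unique-ids = echo-unique p l ids (proj₁ (validEcho-sound p l ids accepted-ids))
      forged-timely⊆ : ∀ {y} → y ∈ filter forged-timely? ids → y ∈ filter forged? (timely p)
      forged-timely⊆ y∈ = let (y∈timely , y-forged) = proj₂ (∈-filter⁻ forged-timely? {xs = ids} y∈) in
                          ∈-filter⁺ forged? y∈timely y-forged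

    forged-votes-per-link≤2t : ∀ p l K → ∑< K (λ y → 𝟙 (forged? y) * vote p y l) ≤ t + t
    forged-votes-per-link≤2t p l K = go (validEcho p l) refl
      where
      go : ∀ m → validEcho p l ≡ m → ∑< K (λ y → 𝟙 (forged? y) * maybe (λ ids → 𝟙 (y ∈? ids)) 0 m) ≤ t + t
      go nothing    _            = ≤-trans (≤-reflexive (trans (∑<-cong K (λ y _ → *-zeroʳ (𝟙 (forged? y))))
                                                              (∑<-zero K)))
                                           z≤n
      go (just ids) accepted-ids = begin
        ∑< K (λ y → 𝟙 (forged? y) * 𝟙 (y ∈? ids)) ≡⟨ ∑<-cong K (λ y _ → *-comm (𝟙 (forged? y)) (𝟙 (y ∈? ids))) ⟩
        ∑< K (λ y → 𝟙 (y ∈? ids) * 𝟙 (forged? y)) ≤⟨ ∑<-members≤ ids (λ y → 𝟙 (forged? y)) K ⟩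
        ∑ ids (λ y → 𝟙 (forged? y))               ≤⟨ forged-entries≤2t p l ids accepted-ids ⟩
        t + t                                     ∎
        where open ≤-Reasoning

    ∑<-forgedVotes≤ : ∀ p K → ∑< K (forgedVotes p) ≤ t * (t + t)
    ∑<-forgedVotes≤ p K = begin
      ∑< K (forgedVotes p)
        ≡⟨ ∑<-∑ processes (λ y l → faulty (port p l) * (𝟙 (forged? y) * vote p y l)) K ⟩
      ∑ processes (λ l → ∑< K (λ y → faulty (port p l) * (𝟙 (forged? y) * vote p y l)))
        ≡⟨ ∑-cong processes (λ l → ∑<-scale (faulty (port p l)) _ K) ⟩
      ∑ processes (λ l → faulty (port p l) * ∑< K (λ y → 𝟙 (forged? y) * vote p y l))
        ≤⟨ ∑-weighted≤ processes (λ l → faulty (port p l)) _ (t + t) (λ l → forged-votes-per-link≤2t p l K) ⟩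
      ∑ processes (λ l → faulty (port p l)) * (t + t)
        ≡⟨ cong (_* (t + t)) (trans (∑-neighbours p faulty) (sym faultyCount≡∑)) ⟩
      faultyCount E * (t + t)
        ≤⟨ *-monoˡ-≤ (t + t) few-faulty ⟩
      t * (t + t) ∎
      where open ≤-Reasoning

    -- Validity: a correct process accepts its own echo over its self-loop …
    myid∈accepted : (∀ p l → suc (toℕ l) ≡ N → port p l ≡ p) →
                    ∀ p → T (correct p) → myid p ∈ accepted p
    myid∈accepted self-loop p p-correct =
      accepted⁺ p l (timely p) (myid p) own-echo (correctIds⊆timely p (correctIds⁺ p p-correct))
      where
      l = greatest p
      loop : port p l ≡ p
      loop = self-loop p l (suc-toℕ-greatest p)
      own-echo : validEcho p l ≡ just (timely p)
      own-echo = trans (correct-echo-accepted p l (subst (T ∘ correct) (sym loop) p-correct))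
                       (cong (just ∘ timely) loop)

    -- … and its own identifier carries the positive weight N - t.
    1≤output : t < N → ∀ p → T (correct p) → 1 ≤ output p
    1≤output t<N p p-correct = begin
      1                                          ≤⟨ m<n⇒0<n∸m t<N ⟩
      N ∸ t                                      ≡⟨ correct-weight p (myid p) (correctIds⁺ p p-correct) ⟨
      weight p (myid p)                          ≤⟨ m≤n+m _ _ ⟩
      ∑< (suc (myid p)) (weight p)               ≡⟨ newid≡∑< p (myid p) ⟨
      output p                                   ∎
      where open ≤-Reasoning

    -- Order preservation: the forged votes of p are outweighed by the weight N - t of myid q.
    output-monotone : 2 * t * t + t < N → ∀ p q → T (correct q) → myid p < myid q → output p < output q
    output-monotone margin p q q-correct id<id′ = begin-strict
      output p                                               ≡⟨ newid≡∑< p (myid p) ⟩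
      ∑< K (weight p)                                        ≤⟨ ∑<-mono K (weight-shift p q) ⟩
      ∑< K (λ y → weight q y + forgedVotes p y)              ≡⟨ ∑<-+ K (weight q) (forgedVotes p) ⟩
      ∑< K (weight q) + ∑< K (forgedVotes p)                 ≤⟨ +-monoʳ-≤ (∑< K (weight q)) (∑<-forgedVotes≤ p K) ⟩
      ∑< K (weight q) + t * (t + t)                          <⟨ +-monoʳ-< (∑< K (weight q)) forgery<N∸t ⟩
      ∑< K (weight q) + (N ∸ t)                              ≡⟨ cong (∑< K (weight q) +_) (correct-weight q (myid q) (correctIds⁺ q q-correct)) ⟨
      ∑< K (weight q) + weight q (myid q)                    ≤⟨ +-monoˡ-≤ (weight q (myid q)) (∑<-prefix (weight q) id<id′) ⟩
      ∑< (suc (myid q)) (weight q)                           ≡⟨ newid≡∑< q (myid q) ⟨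
      output q                                               ∎
      where
      open ≤-Reasoning
      K = suc (myid p)
      forgery<N∸t : t * (t + t) < N ∸ t
      forgery<N∸t = m+n≤o⇒m≤o∸n (suc (t * (t + t))) (subst (λ x → suc x + t ≤ N) 2tt≡t[t+t] margin)
        where
        2tt≡t[t+t] : 2 * t * t ≡ t * (t + t)
        2tt≡t[t+t] = solve 1 (λ t → con 2 :* t :* t := t :* (t :+ t)) refl t

-- The renaming guarantees.
theorem3 : (N t Nmax : ℕ) → 2 * t * t + t < N → (E : Execution N) →
    faultyCount E ≤ t →
    (∀ p → T (Execution.correct E p) → 1 ≤ Execution.myid E p × Execution.myid E p ≤ Nmax) →
    (∀ p q → T (Execution.correct E p) → T (Execution.correct E q) →
      Execution.myid E p ≡ Execution.myid E q → p ≡ q) →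
    (∀ p → Injective _≡_ _≡_ (Execution.port E p)) →
    (∀ p l → suc (toℕ l) ≡ N → Execution.port E p l ≡ p) →
    (∀ b p ids → Execution.byz2 E b p ≡ just ids → Unique ids) →
    (∀ p → T (Execution.correct E p) →
       Execution.myid E p ∈ AlgorithmB.accepted t E p
       × 1 ≤ AlgorithmB.output t E p
       × AlgorithmB.output t E p ≤ N * N)
    × (∀ p q → T (Execution.correct E p) → T (Execution.correct E q) →
       Execution.myid E p < Execution.myid E q →
       AlgorithmB.output t E p < AlgorithmB.output t E q)
theorem3 N t Nmax margin E few-faulty _ ids-distinct port-injective self-loop byz-echo-unique =
  (λ p p-correct → myid∈accepted self-loop p p-correct , 1≤output t<N p p-correct , output≤N² p) ,
  (λ p q _ q-correct → output-monotone margin p q q-correct)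
  where
  open Analysis t E
  open Correctness port-injective ids-distinct few-faulty byz-echo-unique
  t<N : t < N
  t<N = ≤-trans (s≤s (m≤n+m t (2 * t * t))) margin
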